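{- Let $k \ge 1$ and let $G = P_k \square P_2$ be the ladder graph. Then $\textrm{RED:LD}(G) = k+1$ if $k$ is odd and $\textrm{RED:LD}(G) = k+2$ if $k$ is even.
   Context: $P_k$ is the path on $k$ vertices and $\square$ denotes the Cartesian product of graphs. $N(v)$ denotes the open neighborhood of $v$. A set $S \subseteq V(G)$ is a locating-dominating (LD) set if for all $u,v \in V(G)-S$: $N(v)\cap S \neq \varnothing$, and if $u \ne v$ then $N(v) \cap S \neq N(u) \cap S$. A RED:LD set is an LD set $S$ such that $S-\{v\}$ is an LD set for every $v \in S$. $\textrm{RED:LD}(G)$ is the minimum cardinality of a RED:LD set of $G$. -}

module Defs where

open import Data.Nat using (ℕ; zero; suc; _+_; _≤_)
open import Data.Fin using (Fin; toℕ)
open import Data.Fin.Subset using (Subset; _∈_; _∉_; ∣_∣; _-_)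
open import Data.Product using (_×_; _,_; ∃-syntax; Σ-syntax)
open import Data.Sum using (_⊎_)
open import Data.Empty using (⊥)
open import Relation.Nullary using (¬_)
open import Relation.Binary.PropositionalEquality using (_≡_; _≢_)
open import Function.Bundles using (_⇔_)

record Graph (n : ℕ) : Set₁ where
  field
    Adj : Fin n → Fin n → Set

open Graph public

InNS : ∀ {n} → Graph n → Subset n → Fin n → Fin n → Set
InNS G S v w = Adj G v w × w ∈ S

IsLD : ∀ {n} → Graph n → Subset n → Set
IsLD {n} G S =
  (∀ v → v ∉ S → ∃[ w ] InNS G S v w)
  × (∀ u v → u ∉ S → v ∉ S → u ≢ v →
       ¬ (∀ w → InNS G S v w ⇔ InNS G S u w))

IsREDLD : ∀ {n} → Graph n → Subset n → Set
IsREDLD G S = IsLD G S × (∀ v → v ∈ S → IsLD G (S - v))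

REDLD≡ : ∀ {n} → Graph n → ℕ → Set
REDLD≡ {n} G m =
  (Σ[ S ∈ Subset n ] IsREDLD G S × ∣ S ∣ ≡ m)
  × (∀ (S : Subset n) → IsREDLD G S → m ≤ ∣ S ∣)

-- Cartesian product of P_k and P_2 (the ladder), vertices encoded as
-- (i , j) with i < k, j < 2, encoded as combine i j : Fin (k * 2)
-- (a bijection Fin k × Fin 2 → Fin (k * 2), index 2 * i + j).
open import Data.Fin using (combine)

PathAdj : ∀ {m} → Fin m → Fin m → Set
PathAdj i j = suc (toℕ i) ≡ toℕ j ⊎ suc (toℕ j) ≡ toℕ i

BoxAdj : ∀ {m p} → (Fin m → Fin m → Set) → (Fin p → Fin p → Set) →
         Fin m → Fin p → Fin m → Fin p → Set
BoxAdj A B i j i' j' = (i ≡ i' × B j j') ⊎ (A i i' × j ≡ j')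

Ladder : (k : ℕ) → Graph (k Data.Nat.* 2)
Ladder k = record { Adj = λ u v → ∃[ i ] ∃[ j ] ∃[ i' ] ∃[ j' ]
  (u ≡ combine i j × v ≡ combine i' j' × BoxAdj (PathAdj {k}) (PathAdj {2}) i j i' j') }

{-# OPTIONS --safe #-}
-- Write s c for the number of vertices of S in column c. In a RED:LD set every vertex outside S
-- has two neighbours in S and every vertex of S has one, so an empty column lies between two full
-- ones and two adjacent columns carry at least 2 vertices together. If an end column e holds a
-- single vertex, its neighbouring column n is full, and the vertex of n diagonal to the vacancy can
-- only be told apart from the vacancy in S minus itself through the next column m, which is thus
-- non-empty: s e + s n ≥ 3 and s m ≥ 1. Covering the columns by an end block and pairs gives
-- ∣S∣ ≥ k + 1; for even k both end blocks are needed, which gives ∣S∣ ≥ k + 2. Conversely the full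
-- columns 0, 2, 4, … (k odd), resp. 0, 1, 3, 5, … (k even), form a RED:LD set: every empty column is
-- flanked by full ones, and then S minus at most one vertex is still locating-dominating.

module Submission where

open import Defs
open import Data.Bool using (Bool; true; false)
open import Data.Empty using (⊥-elim)
open import Data.Fin using (Fin; toℕ; fromℕ<; combine; quotient; remainder)
open import Data.Fin.Patterns using (0F; 1F)
open import Data.Fin.Properties using (toℕ-injective; toℕ<n; toℕ-fromℕ<; remQuot-combine; combine-remQuot)
open import Data.Fin.Subset using (Subset; ⊤; ⊥; _∈_; _∉_; ∣_∣; _-_; _─_; ⁅_⁆; inside; outside)
open import Data.Fin.Subset.Properties using (_∈?_; ∉⊥; p─⊥≡p; x∈p∧x∉q⇒x∈p─q; p─q⊆p; x∉⁅y⁆⇒x≢y; x∈⁅y⁆⇒x≡y; p⊆q⇒∣p∣≤∣q∣; ∣⁅x⁆∣≡1; ∣⊤∣≡n)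
open import Data.Nat using (ℕ; zero; suc; _+_; _*_; _≤_; _<_; z≤n; s≤s; _%_; _/_)
open import Data.Nat.DivMod using (m≡m%n+[m/n]*n)
open import Data.Nat.Properties using (m≢1+n+m; _≟_; _≤?_; ≰⇒>; +-mono-≤; suc-injective; +-assoc; +-comm; +-identityʳ; ≤-refl; ≤-trans; <-irrefl; n≤1+n; <-trans; n<1+n; m≤n+m)
open import Data.Product using (_×_; _,_; proj₁; proj₂; ∃-syntax)
open import Data.Sum using (_⊎_; inj₁; inj₂)
open import Data.Vec using (_∷_; []; lookup; here; there)
open import Data.Vec.Properties using ([]=⇒lookup; lookup⇒[]=)
open import Function using (_∘_)
open import Function.Bundles using (_⇔_; mk⇔; Equivalence)
open import Function.Properties.Equivalence using () renaming (sym to ⇔-sym)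
open import Relation.Nullary using (¬_; yes; no; contradiction)
open import Relation.Binary.PropositionalEquality using (_≡_; _≢_; refl; sym; trans; cong; cong₂; subst; subst₂; module ≡-Reasoning)

x∈p-y⇒x∈p : ∀ {n} {p : Subset n} {x y} → x ∈ p - y → x ∈ p
x∈p-y⇒x∈p {p = p} {y = y} = p─q⊆p p ⁅ y ⁆

x∈p─q⇒x∉q : ∀ {n} {p q : Subset n} {x} → x ∈ p ─ q → x ∉ q
x∈p─q⇒x∉q {p = _ ∷ _} {inside ∷ _} () here
x∈p─q⇒x∉q {p = _ ∷ _} {outside ∷ _} here ()
x∈p─q⇒x∉q {p = _ ∷ _} {_ ∷ _} (there x∈) (there x∈q) = x∈p─q⇒x∉q x∈ x∈q

x∈p-y⇒x≢y : ∀ {n} {p : Subset n} {x y} → x ∈ p - y → x ≢ y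
x∈p-y⇒x≢y x∈ = x∉⁅y⁆⇒x≢y (x∈p─q⇒x∉q x∈)

∣p∣≡0⇒x∉p : ∀ {n} {p : Subset n} {x} → ∣ p ∣ ≡ 0 → x ∉ p
∣p∣≡0⇒x∉p {p = inside ∷ _} () _
∣p∣≡0⇒x∉p {p = outside ∷ _} e (there x∈) = ∣p∣≡0⇒x∉p e x∈

x∈p⇒1≤∣p∣ : ∀ {n} {p : Subset n} {x} → x ∈ p → 1 ≤ ∣ p ∣
x∈p⇒1≤∣p∣ {p = p} {x} x∈p =
  subst (_≤ ∣ p ∣) (∣⁅x⁆∣≡1 x) (p⊆q⇒∣p∣≤∣q∣ (λ y∈⁅x⁆ → subst (_∈ p) (sym (x∈⁅y⁆⇒x≡y x y∈⁅x⁆)) x∈p))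

∀x∈p⇒n≤∣p∣ : ∀ {n} {p : Subset n} → (∀ x → x ∈ p) → n ≤ ∣ p ∣
∀x∈p⇒n≤∣p∣ {n} {p} all = subst (_≤ ∣ p ∣) (∣⊤∣≡n n) (p⊆q⇒∣p∣≤∣q∣ {p = ⊤} (λ {x} _ → all x))

∣p∣<2⇒∃∉p : (p : Subset 2) → ∣ p ∣ < 2 → ∃[ j ] j ∉ p
∣p∣<2⇒∃∉p (outside ∷ _ ∷ []) _ = 0F , λ ()
∣p∣<2⇒∃∉p (inside ∷ outside ∷ []) _ = 1F , λ { (there ()) }
∣p∣<2⇒∃∉p (inside ∷ inside ∷ []) (s≤s (s≤s ()))

module REDLDProperties {n} (G : Graph n) {S : Subset n} (red : IsREDLD G S) where

  two-neighbours : ∀ {v} → v ∉ S → ∃[ x ] ∃[ y ] (x ≢ y × InNS G S v x × InNS G S v y)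
  two-neighbours {v} v∉S with proj₁ (proj₁ red) v v∉S
  ... | x , vx , x∈S with proj₁ (proj₂ red x x∈S) v (v∉S ∘ x∈p-y⇒x∈p)
  ...   | y , vy , y∈S-x = y , x , x∈p-y⇒x≢y y∈S-x , (vy , x∈p-y⇒x∈p y∈S-x) , (vx , x∈S)

  neighbour : ∀ {v} → v ∈ S → ∃[ x ] InNS G S v x
  neighbour {v} v∈S with proj₁ (proj₂ red v v∈S) v (λ v∈ → x∈p-y⇒x≢y v∈ refl)
  ... | x , vx , x∈S-v = x , vx , x∈p-y⇒x∈p x∈S-v

  separated : ∀ {w u} → w ∈ S → u ∉ S → u ≢ w →
              ¬ (∀ x → InNS G (S - w) w x ⇔ InNS G (S - w) u x)
  separated {w} {u} w∈S u∉S u≢w =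
    proj₂ (proj₂ red w w∈S) u w (u∉S ∘ x∈p-y⇒x∈p) (λ w∈ → x∈p-y⇒x≢y w∈ refl) u≢w

∑ : (ℕ → ℕ) → ℕ → ℕ
∑ f zero = 0
∑ f (suc n) = f 0 + ∑ (f ∘ suc) n

∑-suc : ∀ f n → ∑ f (suc n) ≡ ∑ f n + f n
∑-suc f zero = +-comm (f 0) 0
∑-suc f (suc n) = begin
  f 0 + ∑ (f ∘ suc) (suc n)          ≡⟨ cong (f 0 +_) (∑-suc (f ∘ suc) n) ⟩
  f 0 + (∑ (f ∘ suc) n + f (suc n))  ≡⟨ +-assoc (f 0) _ _ ⟨
  f 0 + ∑ (f ∘ suc) n + f (suc n)    ∎
  where open ≡-Reasoning

record Paired (s : ℕ → ℕ) (k : ℕ) : Set where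
  constructor paired
  field pair : ∀ c → suc c < k → 2 ≤ s c + s (suc c)

open Paired

Paired-tail : ∀ {s k} → Paired s (suc k) → Paired (s ∘ suc) k
Paired-tail p = paired λ c c+1<k → pair p (suc c) (s≤s c+1<k)

Paired-prefix : ∀ {s k m} → m ≤ k → Paired s k → Paired s m
Paired-prefix m≤k p = paired λ c c+1<m → pair p c (≤-trans c+1<m m≤k)

∑-Paired : ∀ s q → Paired s (q * 2) → q * 2 ≤ ∑ s (q * 2)
∑-Paired s zero _ = z≤n
∑-Paired s (suc q) p = subst (2 + q * 2 ≤_) (+-assoc (s 0) (s 1) _)
  (+-mono-≤ (pair p 0 (s≤s (s≤s z≤n))) (∑-Paired (s ∘ suc ∘ suc) q (Paired-tail (Paired-tail p))))

data LeftEnd (s : ℕ → ℕ) (k : ℕ) : Set where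
  full : 2 ≤ s 0 → LeftEnd s k
  thin : 3 ≤ k → 3 ≤ s 0 + s 1 → 1 ≤ s 2 → LeftEnd s k

data RightEnd (s : ℕ → ℕ) : ℕ → Set where
  full : ∀ {e} → 2 ≤ s e → RightEnd s e
  thin : ∀ {m} → 3 ≤ s (2 + m) + s (1 + m) → 1 ≤ s m → RightEnd s (2 + m)

∑-odd : ∀ s q → Paired s (suc (q * 2)) → LeftEnd s (suc (q * 2)) → 2 + q * 2 ≤ ∑ s (suc (q * 2))
∑-odd s q p (full 2≤s₀) = +-mono-≤ 2≤s₀ (∑-Paired (s ∘ suc) q (Paired-tail p))
∑-odd s zero p (thin (s≤s ()) _ _)
∑-odd s (suc q) p (thin _ 3≤s₀+s₁ 1≤s₂) = subst (4 + q * 2 ≤_) (+-assoc (s 0) (s 1) _)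
  (+-mono-≤ 3≤s₀+s₁ (+-mono-≤ 1≤s₂ (∑-Paired (s ∘ suc ∘ suc ∘ suc) q (Paired-tail (Paired-tail (Paired-tail p))))))

∑-last-three : ∀ s m → ∑ s (3 + m) ≡ (∑ s m + s m) + (s (2 + m) + s (1 + m))
∑-last-three s m = begin
  ∑ s (3 + m)                                    ≡⟨ ∑-suc s (2 + m) ⟩
  ∑ s (2 + m) + s (2 + m)                        ≡⟨ cong (_+ s (2 + m)) (∑-suc s (1 + m)) ⟩
  ∑ s (1 + m) + s (1 + m) + s (2 + m)            ≡⟨ +-assoc (∑ s (1 + m)) _ _ ⟩
  ∑ s (1 + m) + (s (1 + m) + s (2 + m))          ≡⟨ cong₂ _+_ (∑-suc s m) (+-comm (s (1 + m)) _) ⟩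
  (∑ s m + s m) + (s (2 + m) + s (1 + m))        ∎
  where open ≡-Reasoning

LeftEnd-shrink : ∀ {s k m} → 3 ≤ m → LeftEnd s k → LeftEnd s m
LeftEnd-shrink _ (full 2≤s₀) = full 2≤s₀
LeftEnd-shrink 3≤m (thin _ 3≤s₀+s₁ 1≤s₂) = thin 3≤m 3≤s₀+s₁ 1≤s₂

∑-after-odd-prefix : ∀ s q → Paired s (suc (suc q) * 2) → LeftEnd s (1 + q * 2) →
                     3 ≤ s (3 + q * 2) + s (2 + q * 2) → 1 ≤ s (1 + q * 2) → 6 + q * 2 ≤ ∑ s (suc (suc q) * 2)
∑-after-odd-prefix s q p left 3≤sₑ+sₙ 1≤sₘ = subst₂ _≤_ arith (sym (∑-last-three s (1 + q * 2)))
    (+-mono-≤ (+-mono-≤ prefix 1≤sₘ) 3≤sₑ+sₙ)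
  where
  prefix : 2 + q * 2 ≤ ∑ s (1 + q * 2)
  prefix = ∑-odd s q (Paired-prefix (≤-trans (n≤1+n _) (≤-trans (n≤1+n _) (n≤1+n _))) p) left
  arith : 2 + q * 2 + 1 + 3 ≡ 6 + q * 2
  arith = trans (+-comm (2 + q * 2 + 1) 3) (cong (3 +_) (+-comm (2 + q * 2) 1))

∑-even-right-thin : ∀ s q → Paired s (suc (suc q) * 2) → LeftEnd s (suc (suc q) * 2) →
                    3 ≤ s (3 + q * 2) + s (2 + q * 2) → 1 ≤ s (1 + q * 2) → 6 + q * 2 ≤ ∑ s (suc (suc q) * 2)
-- For k = 4 the two thin end blocks overlap; the pairs of columns (0, 1) and (2, 3) suffice.
∑-even-right-thin s zero p (thin _ 3≤s₀+s₁ _) 3≤s₃+s₂ _ =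
  subst (6 ≤_) (sym (∑-last-three s 1))
    (+-mono-≤ (subst (3 ≤_) (cong (_+ s 1) (sym (+-identityʳ (s 0)))) 3≤s₀+s₁) 3≤s₃+s₂)
∑-even-right-thin s zero p (full 2≤s₀) = ∑-after-odd-prefix s zero p (full 2≤s₀)
∑-even-right-thin s (suc q) p left = ∑-after-odd-prefix s (suc q) p (LeftEnd-shrink (s≤s (s≤s (s≤s z≤n))) left)

∑-even-right-full : ∀ s q → Paired s (suc q * 2) → LeftEnd s (suc q * 2) → 2 ≤ s (suc (q * 2)) →
                    4 + q * 2 ≤ ∑ s (suc q * 2)
∑-even-right-full s q p left 2≤sₑ = subst₂ _≤_ (+-comm (2 + q * 2) 2) (sym (∑-suc s (suc (q * 2))))
  (+-mono-≤ (∑-odd s q (Paired-prefix (n≤1+n _) p) (left-prefix q left)) 2≤sₑ)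
  where
  left-prefix : ∀ q → LeftEnd s (suc q * 2) → LeftEnd s (suc (q * 2))
  left-prefix q (full 2≤s₀) = full 2≤s₀
  left-prefix zero (thin (s≤s (s≤s ())) _ _)
  left-prefix (suc q) left = LeftEnd-shrink (s≤s (s≤s (s≤s z≤n))) left

∑-even : ∀ s q → Paired s (suc q * 2) → LeftEnd s (suc q * 2) → RightEnd s (suc (q * 2)) →
         4 + q * 2 ≤ ∑ s (suc q * 2)
∑-even s zero p left (full 2≤sₑ) = ∑-even-right-full s zero p left 2≤sₑ
∑-even s (suc q) p left (full 2≤sₑ) = ∑-even-right-full s (suc q) p left 2≤sₑ
∑-even s (suc q) p left (thin 3≤sₑ+sₙ 1≤sₘ) = ∑-even-right-thin s q p left 3≤sₑ+sₙ 1≤sₘ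

Consecutive : ℕ → ℕ → Set
Consecutive a b = suc a ≡ b ⊎ suc b ≡ a

Consecutive-sym : ∀ {a b} → Consecutive a b → Consecutive b a
Consecutive-sym (inj₁ e) = inj₂ e
Consecutive-sym (inj₂ e) = inj₁ e

Consecutive-pigeonhole : ∀ {c a b d} → Consecutive c a → Consecutive c b → Consecutive c d →
                         a ≢ b → d ≡ a ⊎ d ≡ b
Consecutive-pigeonhole (inj₁ refl) (inj₁ refl) _ a≢b = ⊥-elim (a≢b refl)
Consecutive-pigeonhole (inj₂ ca) (inj₂ cb) _ a≢b = ⊥-elim (a≢b (suc-injective (trans ca (sym cb))))
Consecutive-pigeonhole (inj₁ refl) (inj₂ _) (inj₁ refl) _ = inj₁ refl
Consecutive-pigeonhole (inj₁ refl) (inj₂ cb) (inj₂ cd) _ = inj₂ (suc-injective (trans cd (sym cb)))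
Consecutive-pigeonhole (inj₂ _) (inj₁ refl) (inj₁ refl) _ = inj₂ refl
Consecutive-pigeonhole (inj₂ ca) (inj₁ refl) (inj₂ cd) _ = inj₁ (suc-injective (trans cd (sym ca)))

¬Consecutive-3+ : ∀ b → ¬ Consecutive (3 + b) b
¬Consecutive-3+ b (inj₁ e) = m≢1+n+m b (sym e)
¬Consecutive-3+ b (inj₂ e) = m≢1+n+m b (suc-injective e)

Consecutive-common : ∀ {a b x} → Consecutive a x → Consecutive b x → a ≢ b → a ≡ 2 + b ⊎ b ≡ 2 + a
Consecutive-common (inj₁ refl) (inj₁ e) a≢b = ⊥-elim (a≢b (sym (suc-injective e)))
Consecutive-common (inj₁ refl) (inj₂ refl) _ = inj₂ refl
Consecutive-common (inj₂ refl) (inj₁ refl) _ = inj₁ refl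
Consecutive-common (inj₂ refl) (inj₂ refl) a≢b = ⊥-elim (a≢b refl)

other : Fin 2 → Fin 2
other 0F = 1F
other 1F = 0F

other-involutive : ∀ j → other (other j) ≡ j
other-involutive 0F = refl
other-involutive 1F = refl

other-≢ : ∀ j → other j ≢ j
other-≢ 0F ()
other-≢ 1F ()

other-cases : ∀ (j j' : Fin 2) → j' ≡ j ⊎ j' ≡ other j
other-cases 0F 0F = inj₁ refl
other-cases 0F 1F = inj₂ refl
other-cases 1F 0F = inj₂ refl
other-cases 1F 1F = inj₁ refl

PathAdj₂⇒other : ∀ {j j' : Fin 2} → PathAdj j j' → j' ≡ other j
PathAdj₂⇒other {0F} {0F} (inj₁ ())
PathAdj₂⇒other {0F} {0F} (inj₂ ())
PathAdj₂⇒other {0F} {1F} _ = refl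
PathAdj₂⇒other {1F} {0F} _ = refl
PathAdj₂⇒other {1F} {1F} (inj₁ ())
PathAdj₂⇒other {1F} {1F} (inj₂ ())

PathAdj₂-other : ∀ (j : Fin 2) → PathAdj j (other j)
PathAdj₂-other 0F = inj₁ refl
PathAdj₂-other 1F = inj₂ refl

-- Columns c ≥ k are empty.
column : ∀ {k} → Subset (k * 2) → ℕ → Subset 2
column {zero} [] _ = outside ∷ outside ∷ []
column {suc k} (a ∷ b ∷ _) zero = a ∷ b ∷ []
column {suc k} (_ ∷ _ ∷ S) (suc c) = column {k} S c

lookup-combine : ∀ {k} (S : Subset (k * 2)) (i : Fin k) (j : Fin 2) →
                 lookup S (combine i j) ≡ lookup (column {k} S (toℕ i)) j
lookup-combine (a ∷ b ∷ S) 0F 0F = refl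
lookup-combine (a ∷ b ∷ S) 0F 1F = refl
lookup-combine {suc k} (a ∷ b ∷ S) (Fin.suc i) j = lookup-combine {k} S i j

∣x∷y∷p∣ : ∀ {n} x y (p : Subset n) → ∣ x ∷ y ∷ p ∣ ≡ ∣ x ∷ y ∷ [] ∣ + ∣ p ∣
∣x∷y∷p∣ outside outside p = refl
∣x∷y∷p∣ outside inside p = refl
∣x∷y∷p∣ inside outside p = refl
∣x∷y∷p∣ inside inside p = refl

∣S∣≡∑∣column∣ : ∀ {k} (S : Subset (k * 2)) → ∣ S ∣ ≡ ∑ (λ c → ∣ column {k} S c ∣) k
∣S∣≡∑∣column∣ {zero} [] = refl
∣S∣≡∑∣column∣ {suc k} (a ∷ b ∷ S) = trans (∣x∷y∷p∣ a b S) (cong (∣ a ∷ b ∷ [] ∣ +_) (∣S∣≡∑∣column∣ {k} S))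

1≤∣column∣⇒<k : ∀ {k} (S : Subset (k * 2)) c → 1 ≤ ∣ column {k} S c ∣ → c < k
1≤∣column∣⇒<k {zero} [] c ()
1≤∣column∣⇒<k {suc k} (a ∷ b ∷ S) zero _ = s≤s z≤n
1≤∣column∣⇒<k {suc k} (a ∷ b ∷ S) (suc c) h = s≤s (1≤∣column∣⇒<k {k} S c h)

module LadderCoordinates (k : ℕ) where

  Vertex : Set
  Vertex = Fin (k * 2)

  col : Vertex → ℕ
  col x = toℕ (quotient {k} 2 x)

  row : Vertex → Fin 2
  row x = remainder {k} 2 x

  col<k : ∀ x → col x < k
  col<k x = toℕ<n (quotient {k} 2 x)

  combine-col-row : ∀ x → combine (quotient {k} 2 x) (row x) ≡ x
  combine-col-row x = combine-remQuot {k} 2 x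

  col-combine : ∀ (i : Fin k) (j : Fin 2) → col (combine i j) ≡ toℕ i
  col-combine i j = cong (toℕ ∘ proj₁) (remQuot-combine i j)

  row-combine : ∀ (i : Fin k) (j : Fin 2) → row (combine i j) ≡ j
  row-combine i j = cong proj₂ (remQuot-combine i j)

  coordinates-injective : ∀ {x y} → col x ≡ col y → row x ≡ row y → x ≡ y
  coordinates-injective {x} {y} c r = begin
    x                                         ≡⟨ combine-col-row x ⟨
    combine (quotient {k} 2 x) (row x)         ≡⟨ cong₂ combine (toℕ-injective c) r ⟩
    combine (quotient {k} 2 y) (row y)         ≡⟨ combine-col-row y ⟩
    y                                         ∎
    where open ≡-Reasoning

  vertex : (c : ℕ) → c < k → Fin 2 → Vertex
  vertex c c<k j = combine (fromℕ< c<k) j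

  col-vertex : ∀ {c} (c<k : c < k) j → col (vertex c c<k j) ≡ c
  col-vertex c<k j = trans (col-combine (fromℕ< c<k) j) (toℕ-fromℕ< c<k)

  row-vertex : ∀ {c} (c<k : c < k) j → row (vertex c c<k j) ≡ j
  row-vertex c<k j = row-combine (fromℕ< c<k) j

  ≡vertex : ∀ {x c j} (c<k : c < k) → col x ≡ c → row x ≡ j → x ≡ vertex c c<k j
  ≡vertex c<k c r = coordinates-injective (trans c (sym (col-vertex c<k _))) (trans r (sym (row-vertex c<k _)))

  data Step (x y : Vertex) : Set where
    rung : col x ≡ col y → row y ≡ other (row x) → Step x y
    rail : Consecutive (col x) (col y) → row x ≡ row y → Step x y

  Adj⇒Step : ∀ {x y} → Adj (Ladder k) x y → Step x y
  Adj⇒Step (i , j , i' , j' , refl , refl , inj₁ (refl , jj')) =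
    rung (trans (col-combine i j) (sym (col-combine i j')))
         (trans (row-combine i j') (trans (PathAdj₂⇒other jj') (cong other (sym (row-combine i j)))))
  Adj⇒Step (i , j , i' , j' , refl , refl , inj₂ (ii' , refl)) =
    rail (subst₂ Consecutive (sym (col-combine i j)) (sym (col-combine i' j)) ii')
         (trans (row-combine i j) (sym (row-combine i' j)))

  Step⇒Adj : ∀ {x y} → Step x y → Adj (Ladder k) x y
  Step⇒Adj {x} {y} s = quotient {k} 2 x , row x , quotient {k} 2 y , row y ,
    sym (combine-col-row x) , sym (combine-col-row y) , box s
    where
    box : Step x y → BoxAdj (PathAdj {k}) (PathAdj {2}) (quotient {k} 2 x) (row x) (quotient {k} 2 y) (row y)
    box (rung c r) = inj₁ (toℕ-injective c , subst (PathAdj (row x)) (sym r) (PathAdj₂-other (row x)))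
    box (rail c r) = inj₂ (c , r)

  partner : Vertex → Vertex
  partner x = vertex (col x) (col<k x) (other (row x))

  col-partner : ∀ x → col (partner x) ≡ col x
  col-partner x = col-vertex (col<k x) _

  row-partner : ∀ x → row (partner x) ≡ other (row x)
  row-partner x = row-vertex (col<k x) _

  partner-involutive : ∀ x → partner (partner x) ≡ x
  partner-involutive x = coordinates-injective (trans (col-partner (partner x)) (col-partner x))
    (trans (row-partner (partner x)) (trans (cong other (row-partner x)) (other-involutive (row x))))

  partner-Step : ∀ x → Step x (partner x)
  partner-Step x = rung (sym (col-partner x)) (row-partner x)

  partner-≢ : ∀ x → partner x ≢ x
  partner-≢ x e = other-≢ (row x) (trans (sym (row-partner x)) (cong row e))

  rung⇒partner : ∀ {x y} → col x ≡ col y → row y ≡ other (row x) → y ≡ partner x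
  rung⇒partner c r = ≡vertex (col<k _) (sym c) r

  rail-at : ∀ {x y a b j} → col x ≡ a → col y ≡ b → Consecutive a b → row x ≡ j → row y ≡ j →
            Adj (Ladder k) x y
  rail-at refl refl ab rx ry = Step⇒Adj (rail ab (trans rx (sym ry)))

  rung-at : ∀ {x y a j} → col x ≡ a → col y ≡ a → row x ≡ j → row y ≡ other j → Adj (Ladder k) x y
  rung-at refl cy refl ry = Step⇒Adj (rung (sym cy) ry)

  lookup-column : ∀ (S : Subset (k * 2)) x → lookup S x ≡ lookup (column {k} S (col x)) (row x)
  lookup-column S x = trans (cong (lookup S) (sym (combine-col-row x))) (lookup-combine {k} S (quotient {k} 2 x) (row x))

  ∈⇒∈column : ∀ {S : Subset (k * 2)} {x} → x ∈ S → row x ∈ column {k} S (col x)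
  ∈⇒∈column {S} {x} x∈S =
    lookup⇒[]= (row x) (column {k} S (col x)) (trans (sym (lookup-column S x)) ([]=⇒lookup x∈S))

  ∈column⇒∈ : ∀ {S : Subset (k * 2)} {x} → row x ∈ column {k} S (col x) → x ∈ S
  ∈column⇒∈ {S} {x} x∈ = lookup⇒[]= x S (trans (lookup-column S x) ([]=⇒lookup x∈))

  ∈column : ∀ {S : Subset (k * 2)} {x c j} → x ∈ S → col x ≡ c → row x ≡ j → j ∈ column {k} S c
  ∈column x∈S refl refl = ∈⇒∈column x∈S

  vertex-∈ : ∀ {S : Subset (k * 2)} {c j} (c<k : c < k) → j ∈ column {k} S c → vertex c c<k j ∈ S
  vertex-∈ {S} {c} {j} c<k j∈ =
    ∈column⇒∈ (subst₂ (λ c' j' → j' ∈ column {k} S c') (sym (col-vertex c<k j)) (sym (row-vertex c<k j)) j∈)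

module ColumnSizes {k} {S : Subset (k * 2)} (red : IsREDLD (Ladder k) S) where
  open LadderCoordinates k
  open REDLDProperties (Ladder k) red

  size : ℕ → ℕ
  size c = ∣ column {k} S c ∣

  rail-neighbour-of : ∀ {v z} → partner v ∉ S → Adj (Ladder k) v z → z ∈ S →
                      Consecutive (col v) (col z) × row z ≡ row v
  rail-neighbour-of pv∉S vz z∈S with Adj⇒Step vz
  ... | rung c r = ⊥-elim (pv∉S (subst (_∈ S) (rung⇒partner c r) z∈S))
  ... | rail c r = c , sym r

  rail-neighbour : ∀ {v c} → v ∉ S → partner v ∉ S → Consecutive (col v) c → c < k →
                   row v ∈ column {k} S c
  rail-neighbour {v} {c} v∉S pv∉S vc c<k with two-neighbours v∉S
  ... | x , y , x≢y , (vx , x∈S) , (vy , y∈S)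
      with rail-neighbour-of pv∉S vx x∈S | rail-neighbour-of pv∉S vy y∈S
  ...   | vx' , rx | vy' , ry
      with Consecutive-pigeonhole vx' vy' vc (λ c≡ → x≢y (coordinates-injective c≡ (trans rx (sym ry))))
  ...     | inj₁ refl = ∈column x∈S refl rx
  ...     | inj₂ refl = ∈column y∈S refl ry

  empty⇒neighbour-full : ∀ {c c'} → c < k → size c ≡ 0 → Consecutive c c' → c' < k → 2 ≤ size c'
  empty⇒neighbour-full {c} {c'} c<k size≡0 cc' c'<k = ∀x∈p⇒n≤∣p∣ λ j →
    subst (_∈ column {k} S c') (row-vertex c<k j)
      (rail-neighbour (empty (col-vertex c<k j)) (empty (trans (col-partner _) (col-vertex c<k j)))
                      (subst (λ z → Consecutive z c') (sym (col-vertex c<k j)) cc') c'<k)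
    where
    empty : ∀ {x} → col x ≡ c → x ∉ S
    empty refl x∈S = ∣p∣≡0⇒x∉p size≡0 (∈⇒∈column x∈S)

  size-pair : ∀ c → suc c < k → 2 ≤ size c + size (suc c)
  size-pair c c+1<k with size c in eq₀ | size (suc c) in eq₁
  ... | zero | s₁ = subst (2 ≤_) eq₁ (empty⇒neighbour-full (<-trans (n<1+n c) c+1<k) eq₀ (inj₁ refl) c+1<k)
  ... | suc s₀ | zero = subst (2 ≤_) (trans eq₀ (sym (+-identityʳ (suc s₀))))
                          (empty⇒neighbour-full c+1<k eq₁ (inj₂ refl) (<-trans (n<1+n c) c+1<k))
  ... | suc s₀ | suc s₁ = s≤s (≤-trans (s≤s z≤n) (m≤n+m (suc s₁) s₀))

  module _ {e n m} (e<k : e < k) (en : Consecutive e n)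
           (e-end : ∀ {c} → c < k → Consecutive e c → c ≡ n)
           (n-next : ∀ {c} → c < k → Consecutive n c → c ≢ e → c ≡ m) where

    private
      ThinEnd : Fin 2 → Set
      ThinEnd j = other j ∈ column {k} S e × j ∈ column {k} S n × other j ∈ column {k} S n

      end-neighbour : ∀ {x z} → col x ≡ e → Adj (Ladder k) x z → z ≡ partner x ⊎ (col z ≡ n × row z ≡ row x)
      end-neighbour {x} {z} refl xz with Adj⇒Step xz
      ... | rung c r = inj₁ (rung⇒partner c r)
      ... | rail c r = inj₂ (e-end (col<k z) c , sym r)

      thin-end : ∀ {j} → vertex e e<k j ∉ S → ThinEnd j
      thin-end {j} v∉S = split (two-neighbours v∉S)
        where
        v = vertex e e<k j
        cv = col-vertex e<k j
        rv = row-vertex e<k j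
        cpv = trans (col-partner v) cv
        rpv = trans (row-partner v) (cong other rv)
        second-rail : partner v ∈ S → other j ∈ column {k} S n
        second-rail pv∈S with neighbour pv∈S
        ... | z , pvz , z∈S with end-neighbour cpv pvz
        ...   | inj₁ refl = ⊥-elim (v∉S (subst (_∈ S) (partner-involutive v) z∈S))
        ...   | inj₂ (cz , rz) = ∈column z∈S cz (trans rz rpv)
        partner-and-rail : partner v ∈ S → ∀ {y} → y ∈ S → col y ≡ n → row y ≡ row v → ThinEnd j
        partner-and-rail pv∈S y∈S cy ry = ∈column pv∈S cpv rpv , ∈column y∈S cy (trans ry rv) , second-rail pv∈S
        split : ∃[ x ] ∃[ y ] (x ≢ y × InNS (Ladder k) S v x × InNS (Ladder k) S v y) → ThinEnd j
        split (x , y , x≢y , (vx , x∈S) , (vy , y∈S)) with end-neighbour cv vx | end-neighbour cv vy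
        ... | inj₁ px | inj₁ py = ⊥-elim (x≢y (trans px (sym py)))
        ... | inj₂ (cx , rx) | inj₂ (cy , ry) = ⊥-elim (x≢y (coordinates-injective (trans cx (sym cy)) (trans rx (sym ry))))
        ... | inj₁ refl | inj₂ (cy , ry) = partner-and-rail x∈S y∈S cy ry
        ... | inj₂ (cx , rx) | inj₁ refl = partner-and-rail y∈S x∈S cx rx

      -- v = (e, j) and w = (n, other j) have the same neighbours in S - w, except possibly (m, other j).
      beyond-end : ∀ {j} → vertex e e<k j ∉ S → ThinEnd j → 1 ≤ size m
      beyond-end {j} v∉S (_ , jn , j'n) with size m in size≡
      ... | suc _ = s≤s z≤n
      ... | zero = ⊥-elim (separated w∈S v∉S v≢w λ x →
                     mk⇔ (λ (wx , x∈) → from-w wx (x∈p-y⇒x∈p x∈) , x∈) (λ (vx , x∈) → from-v vx , x∈))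
        where
        n<k = 1≤∣column∣⇒<k {k} S n (x∈p⇒1≤∣p∣ jn)
        v = vertex e e<k j
        w = vertex n n<k (other j)
        cv = col-vertex e<k j
        rv = row-vertex e<k j
        cw = col-vertex n<k (other j)
        rw = row-vertex n<k (other j)
        w∈S = vertex-∈ n<k j'n
        v≢w : v ≢ w
        v≢w v≡w = other-≢ j (trans (sym rw) (trans (cong row (sym v≡w)) rv))
        from-w : ∀ {x} → Adj (Ladder k) w x → x ∈ S → Adj (Ladder k) v x
        from-w {x} wx x∈S with Adj⇒Step wx
        ... | rung c r = rail-at cv (trans (sym c) cw) en rv (trans r (trans (cong other rw) (other-involutive j)))
        ... | rail c r with col x ≟ e
        ...   | yes ce = rung-at cv ce rv (trans (sym r) rw)
        ...   | no ce = ⊥-elim (∣p∣≡0⇒x∉p size≡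
                          (∈column x∈S (n-next (col<k x) (subst (λ a → Consecutive a (col x)) cw c) ce) refl))
        from-v : ∀ {x} → Adj (Ladder k) v x → Adj (Ladder k) w x
        from-v {x} vx with Adj⇒Step vx
        ... | rung c r = rail-at cw (trans (sym c) cv) (Consecutive-sym en) rw (trans r (cong other rv))
        ... | rail c r = rung-at cw (e-end (col<k x) (subst (λ a → Consecutive a (col x)) cv c))
                           rw (trans (sym r) (trans rv (sym (other-involutive j))))

      thin-bound : ∀ {j} → vertex e e<k j ∉ S → ThinEnd j → 3 ≤ size e + size n × 1 ≤ size m
      thin-bound {j} v∉S ends@(j'e , jn , j'n) =
        +-mono-≤ (x∈p⇒1≤∣p∣ j'e) (∀x∈p⇒n≤∣p∣ n-full) , beyond-end v∉S ends
        where
        n-full : ∀ j' → j' ∈ column {k} S n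
        n-full j' with other-cases j j'
        ... | inj₁ refl = jn
        ... | inj₂ refl = j'n

    end-column : 2 ≤ size e ⊎ (3 ≤ size e + size n × 1 ≤ size m)
    end-column with 2 ≤? size e
    ... | yes 2≤size = inj₁ 2≤size
    ... | no 2≰size with ∣p∣<2⇒∃∉p (column {k} S e) (≰⇒> 2≰size)
    ...   | j , j∉ = inj₂ (thin-bound v∉S (thin-end v∉S))
      where
      v∉S : vertex e e<k j ∉ S
      v∉S v∈S = j∉ (∈column v∈S (col-vertex e<k j) (row-vertex e<k j))

  paired-size : Paired size k
  paired-size = paired size-pair

  left-end : 0 < k → LeftEnd size k
  left-end 0<k = from-end-column (end-column 0<k (inj₁ refl) 0-end 1-next)
    where
    0-end : ∀ {c} → c < k → Consecutive 0 c → c ≡ 1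
    0-end _ (inj₁ refl) = refl
    1-next : ∀ {c} → c < k → Consecutive 1 c → c ≢ 0 → c ≡ 2
    1-next _ (inj₁ refl) _ = refl
    1-next _ (inj₂ refl) c≢0 = ⊥-elim (c≢0 refl)
    from-end-column : 2 ≤ size 0 ⊎ (3 ≤ size 0 + size 1 × 1 ≤ size 2) → LeftEnd size k
    from-end-column (inj₁ 2≤size₀) = full 2≤size₀
    from-end-column (inj₂ (3≤size₀+size₁ , 1≤size₂)) =
      thin (1≤∣column∣⇒<k {k} S 2 1≤size₂) 3≤size₀+size₁ 1≤size₂

  right-end : ∀ e → suc (suc e) ≡ k → RightEnd size (suc e)
  right-end zero refl = from-end-column (end-column {m = 2} ≤-refl (inj₂ refl) 1-end 0-next)
    where
    1-end : ∀ {c} → c < 2 → Consecutive 1 c → c ≡ 0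
    1-end (s≤s (s≤s ())) (inj₁ refl)
    1-end _ (inj₂ refl) = refl
    0-next : ∀ {c} → c < 2 → Consecutive 0 c → c ≢ 1 → c ≡ 2
    0-next _ (inj₁ refl) c≢1 = ⊥-elim (c≢1 refl)
    from-end-column : 2 ≤ size 1 ⊎ (3 ≤ size 1 + size 0 × 1 ≤ size 2) → RightEnd size 1
    from-end-column (inj₁ 2≤size₁) = full 2≤size₁
    from-end-column (inj₂ (_ , 1≤size₂)) with 1≤∣column∣⇒<k {k} S 2 1≤size₂
    ... | s≤s (s≤s ())
  right-end (suc m) refl = from-end-column (end-column ≤-refl (inj₂ refl) last-end next)
    where
    last-end : ∀ {c} → c < 3 + m → Consecutive (2 + m) c → c ≡ 1 + m
    last-end c<k (inj₁ refl) = ⊥-elim (<-irrefl refl c<k)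
    last-end _ (inj₂ refl) = refl
    next : ∀ {c} → c < 3 + m → Consecutive (1 + m) c → c ≢ 2 + m → c ≡ m
    next _ (inj₁ refl) c≢e = ⊥-elim (c≢e refl)
    next _ (inj₂ refl) _ = refl
    from-end-column : 2 ≤ size (2 + m) ⊎ (3 ≤ size (2 + m) + size (1 + m) × 1 ≤ size m) → RightEnd size (2 + m)
    from-end-column (inj₁ 2≤sizeₑ) = full 2≤sizeₑ
    from-end-column (inj₂ (3≤sizeₑ+sizeₙ , 1≤sizeₘ)) = thin 3≤sizeₑ+sizeₙ 1≤sizeₘ

odd-ladder-REDLD-size : ∀ q {S : Subset (suc (q * 2) * 2)} → IsREDLD (Ladder (suc (q * 2))) S → 2 + q * 2 ≤ ∣ S ∣
odd-ladder-REDLD-size q {S} red = subst (2 + q * 2 ≤_) (sym (∣S∣≡∑∣column∣ {suc (q * 2)} S))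
  (∑-odd size q paired-size (left-end (s≤s z≤n)))
  where open ColumnSizes red

even-ladder-REDLD-size : ∀ q {S : Subset (suc q * 2 * 2)} → IsREDLD (Ladder (suc q * 2)) S → 4 + q * 2 ≤ ∣ S ∣
even-ladder-REDLD-size q {S} red = subst (4 + q * 2 ≤_) (sym (∣S∣≡∑∣column∣ {suc q * 2} S))
  (∑-even size q paired-size (left-end (s≤s z≤n)) (right-end (q * 2) refl))
  where open ColumnSizes red

Flanked : (ℕ → Bool) → ℕ → Set
Flanked f k = ∀ c → c < k → f c ≡ false → ∃[ c' ] (c ≡ suc c' × f c' ≡ true × suc c < k × f (suc c) ≡ true)

module FullColumns {k} (f : ℕ → Bool) (flanked : Flanked f k) {S : Subset (k * 2)}
                   (lookup-S : ∀ x → lookup S x ≡ f (LadderCoordinates.col k x)) where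
  open LadderCoordinates k

  full⇒∈ : ∀ {x} → f (col x) ≡ true → x ∈ S
  full⇒∈ {x} e = lookup⇒[]= x S (trans (lookup-S x) e)

  ∈⇒full : ∀ {x} → x ∈ S → f (col x) ≡ true
  ∈⇒full {x} x∈S = trans (sym (lookup-S x)) ([]=⇒lookup x∈S)

  empty⇒∉ : ∀ {x} → f (col x) ≡ false → x ∉ S
  empty⇒∉ e x∈S with trans (sym (∈⇒full x∈S)) e
  ... | ()

  full-or-empty : ∀ x → f (col x) ≡ true ⊎ f (col x) ≡ false
  full-or-empty x with f (col x)
  ... | true = inj₁ refl
  ... | false = inj₂ refl

  record Flanks (y : Vertex) : Set where
    field
      left right : Vertex
      left-col : suc (col left) ≡ col y
      right-col : col right ≡ suc (col y)
      left-row : row left ≡ row y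
      right-row : row right ≡ row y
      left∈S : left ∈ S
      right∈S : right ∈ S

    left-adj : Adj (Ladder k) y left
    left-adj = Step⇒Adj (rail (inj₂ left-col) (sym left-row))

    right-adj : Adj (Ladder k) y right
    right-adj = Step⇒Adj (rail (inj₁ (sym right-col)) (sym right-row))

    left≢right : left ≢ right
    left≢right l≡r = m≢1+n+m (col left) (trans (cong col l≡r) (trans right-col (cong suc (sym left-col))))

  flanks : ∀ y → f (col y) ≡ false → Flanks y
  flanks y e with flanked (col y) (col<k y) e
  ... | c' , c≡ , fc' , c+1<k , fc+1 = record
    { left = vertex c' c'<k (row y) ; right = vertex (suc (col y)) c+1<k (row y)
    ; left-col = trans (cong suc (col-vertex c'<k _)) (sym c≡) ; right-col = col-vertex c+1<k _
    ; left-row = row-vertex c'<k _ ; right-row = row-vertex c+1<k _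
    ; left∈S = full⇒∈ (trans (cong f (col-vertex c'<k _)) fc')
    ; right∈S = full⇒∈ (trans (cong f (col-vertex c+1<k _)) fc+1) }
    where
    c'<k : c' < k
    c'<k = <-trans (subst (c' <_) (sym c≡) (n<1+n c')) (col<k y)

  rail-only : ∀ {y x} → f (col y) ≡ false → Adj (Ladder k) y x → x ∈ S →
              Consecutive (col y) (col x) × row x ≡ row y
  rail-only {y} {x} e yx x∈S with Adj⇒Step yx
  ... | rung c _ = ⊥-elim (empty⇒∉ (subst (λ c → f c ≡ false) c e) x∈S)
  ... | rail c r = c , sym r

  module _ (R : Subset (k * 2)) (R-subsingleton : ∀ {x y} → x ∈ R → y ∈ R → x ≡ y) where

    private
      T = S ─ R

      ∈T : ∀ {x} → x ∈ S → x ∉ R → x ∈ T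
      ∈T = x∈p∧x∉q⇒x∈p─q

      ∉T⇒∈R : ∀ {x} → f (col x) ≡ true → x ∉ T → x ∈ R
      ∉T⇒∈R {x} e x∉T with x ∈? R
      ... | yes x∈R = x∈R
      ... | no x∉R = ⊥-elim (x∉T (∈T (full⇒∈ e) x∉R))

      partner∈T : ∀ {v} → f (col v) ≡ true → v ∈ R → partner v ∈ T
      partner∈T {v} e v∈R = ∈T (full⇒∈ (trans (cong f (col-partner v)) e))
                               (λ pv∈R → partner-≢ v (R-subsingleton pv∈R v∈R))

      dominated-empty : ∀ y → f (col y) ≡ false → ∃[ x ] InNS (Ladder k) T y x
      dominated-empty y e with flanks y e
      ... | fl with Flanks.left fl ∈? R
      ...   | no l∉R = Flanks.left fl , Flanks.left-adj fl , ∈T (Flanks.left∈S fl) l∉R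
      ...   | yes l∈R = Flanks.right fl , Flanks.right-adj fl ,
                        ∈T (Flanks.right∈S fl) (λ r∈R → Flanks.left≢right fl (R-subsingleton l∈R r∈R))

      dominated : ∀ v → v ∉ T → ∃[ x ] InNS (Ladder k) T v x
      dominated v v∉T with full-or-empty v
      ... | inj₂ e = dominated-empty v e
      ... | inj₁ e = partner v , Step⇒Adj (partner-Step v) , partner∈T e (∉T⇒∈R e v∉T)

      empty-two-apart : ∀ {u v} → f (col u) ≡ false → f (col v) ≡ false → col u ≡ 2 + col v →
                        ¬ (∀ x → InNS (Ladder k) T v x ⇔ InNS (Ladder k) T u x)
      empty-two-apart {u} {v} eu ev cu H with flanks v ev | flanks u eu
      ... | fv | fu with Flanks.left fv ∈? R
      ...   | no l∉R = ¬Consecutive-3+ (col lv) (subst (λ c → Consecutive c (col lv)) u≡3+lv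
                 (proj₁ (rail-only eu (proj₁ h) (p─q⊆p S R (proj₂ h)))))
        where
        lv = Flanks.left fv
        u≡3+lv = trans cu (cong (2 +_) (sym (Flanks.left-col fv)))
        h = Equivalence.to (H lv) (Flanks.left-adj fv , ∈T (Flanks.left∈S fv) l∉R)
      ...   | yes l∈R = ¬Consecutive-3+ (col v) (Consecutive-sym (subst (Consecutive (col v)) ru≡3+v
                 (proj₁ (rail-only ev (proj₁ h) (p─q⊆p S R (proj₂ h))))))
        where
        ru = Flanks.right fu
        ru≡3+v = trans (Flanks.right-col fu) (cong suc cu)
        r∉R : ru ∉ R
        r∉R r∈R = m≢1+n+m (col (Flanks.left fv)) (trans (cong col (R-subsingleton l∈R r∈R))
                    (trans ru≡3+v (cong (3 +_) (sym (Flanks.left-col fv)))))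
        h = Equivalence.from (H ru) (Flanks.right-adj fu , ∈T (Flanks.right∈S fu) r∉R)

      empty-vs-full : ∀ {u v} → f (col u) ≡ false → f (col v) ≡ true → v ∉ T →
                      ¬ (∀ x → InNS (Ladder k) T v x ⇔ InNS (Ladder k) T u x)
      empty-vs-full {u} {v} eu ev v∉T H = m≢1+n+m (col (Flanks.left fu)) (begin
          col (Flanks.left fu)       ≡⟨ rung-col (Flanks.left-row fu) (Flanks.left-adj fu) (Flanks.left∈S fu) ⟨
          col v                      ≡⟨ rung-col (Flanks.right-row fu) (Flanks.right-adj fu) (Flanks.right∈S fu) ⟩
          col (Flanks.right fu)      ≡⟨ Flanks.right-col fu ⟩
          suc (col u)                ≡⟨ cong suc (Flanks.left-col fu) ⟨
          2 + col (Flanks.left fu)   ∎)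
        where
        open ≡-Reasoning
        v∈R = ∉T⇒∈R ev v∉T
        fu = flanks u eu
        row-u : row u ≡ other (row v)
        row-u with Equivalence.to (H (partner v)) (Step⇒Adj (partner-Step v) , partner∈T ev v∈R)
        ... | upv , pv∈T = trans (sym (proj₂ (rail-only eu upv (p─q⊆p S R pv∈T)))) (row-partner v)
        row-u⇒∉R : ∀ {z} → row z ≡ row u → z ∉ R
        row-u⇒∉R rz z∈R = other-≢ (row v) (sym (trans (cong row (R-subsingleton v∈R z∈R)) (trans rz row-u)))
        rung-col : ∀ {z} → row z ≡ row u → Adj (Ladder k) u z → z ∈ S → col v ≡ col z
        rung-col {z} rz uz z∈S with Adj⇒Step (proj₁ (Equivalence.from (H z) (uz , ∈T z∈S (row-u⇒∉R rz))))
        ... | rung c _ = c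
        ... | rail _ r = ⊥-elim (other-≢ (row v) (sym (trans r (trans rz row-u))))

      located : ∀ u v → u ∉ T → v ∉ T → u ≢ v → ¬ (∀ x → InNS (Ladder k) T v x ⇔ InNS (Ladder k) T u x)
      located u v u∉T v∉T u≢v H with full-or-empty u | full-or-empty v
      ... | inj₁ eu | inj₁ ev = u≢v (R-subsingleton (∉T⇒∈R eu u∉T) (∉T⇒∈R ev v∉T))
      ... | inj₂ eu | inj₁ ev = empty-vs-full eu ev v∉T H
      ... | inj₁ eu | inj₂ ev = empty-vs-full ev eu u∉T (λ x → ⇔-sym (H x))
      ... | inj₂ eu | inj₂ ev with dominated-empty v ev
      ...   | x , vx , x∈T with Equivalence.to (H x) (vx , x∈T)
      ...     | ux , _ with rail-only eu ux (p─q⊆p S R x∈T) | rail-only ev vx (p─q⊆p S R x∈T)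
      ...       | cu , ru | cv , rv with Consecutive-common cu cv (λ c → u≢v (coordinates-injective c (trans (sym ru) rv)))
      ...         | inj₁ u≡2+v = empty-two-apart eu ev u≡2+v H
      ...         | inj₂ v≡2+u = empty-two-apart ev eu v≡2+u (λ x → ⇔-sym (H x))

    minus-subsingleton-LD : IsLD (Ladder k) (S ─ R)
    minus-subsingleton-LD = dominated , located

  isREDLD : IsREDLD (Ladder k) S
  isREDLD = subst (IsLD (Ladder k)) (p─⊥≡p S) (minus-subsingleton-LD ⊥ (λ x∈⊥ → ⊥-elim (∉⊥ x∈⊥)))
        , λ v v∈S → minus-subsingleton-LD ⁅ v ⁆ λ x∈ y∈ → trans (x∈⁅y⁆⇒x≡y v x∈) (sym (x∈⁅y⁆⇒x≡y v y∈))

fullColumns : (ℕ → Bool) → (k : ℕ) → Subset (k * 2)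
fullColumns f zero = []
fullColumns f (suc k) = f 0 ∷ f 0 ∷ fullColumns (f ∘ suc) k

lookup-fullColumns : ∀ f k (i : Fin k) j → lookup (fullColumns f k) (combine i j) ≡ f (toℕ i)
lookup-fullColumns f (suc k) 0F 0F = refl
lookup-fullColumns f (suc k) 0F 1F = refl
lookup-fullColumns f (suc k) (Fin.suc i) j = lookup-fullColumns (f ∘ suc) k i j

fullColumns-REDLD : ∀ f k → Flanked f k → IsREDLD (Ladder k) (fullColumns f k)
fullColumns-REDLD f k flanked = FullColumns.isREDLD f flanked λ x → begin
  lookup (fullColumns f k) x                                  ≡⟨ cong (lookup (fullColumns f k)) (combine-col-row x) ⟨
  lookup (fullColumns f k) (combine (quotient {k} 2 x) (row x)) ≡⟨ lookup-fullColumns f k _ _ ⟩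
  f (col x)                                                   ∎
  where
  open ≡-Reasoning
  open LadderCoordinates k

isEven : ℕ → Bool
isEven zero = true
isEven (suc zero) = false
isEven (suc (suc c)) = isEven c

isEven-flanked : ∀ q → Flanked isEven (suc (q * 2))
isEven-flanked q zero _ ()
isEven-flanked zero (suc zero) (s≤s ()) _
isEven-flanked (suc q) (suc zero) _ _ = 0 , refl , refl , s≤s (s≤s (s≤s z≤n)) , refl
isEven-flanked zero (suc (suc c)) (s≤s ()) _
isEven-flanked (suc q) (suc (suc c)) (s≤s (s≤s c<k)) e with isEven-flanked q c c<k e
... | c' , refl , ec' , c+1<k , ec+1 = suc (suc c') , refl , ec' , s≤s (s≤s c+1<k) , ec+1

isZeroOrOdd : ℕ → Bool
isZeroOrOdd zero = true
isZeroOrOdd (suc c) = isEven c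

isZeroOrOdd-flanked : ∀ q → Flanked isZeroOrOdd (suc q * 2)
isZeroOrOdd-flanked q zero _ ()
isZeroOrOdd-flanked q (suc c) (s≤s c<k) e with isEven-flanked q c c<k e
... | c' , refl , ec' , c+1<k , ec+1 = suc c' , refl , ec' , s≤s c+1<k , ec+1

∣fullColumns-isEven∣ : ∀ q → ∣ fullColumns isEven (suc (q * 2)) ∣ ≡ 2 + q * 2
∣fullColumns-isEven∣ zero = refl
∣fullColumns-isEven∣ (suc q) = cong (2 +_) (∣fullColumns-isEven∣ q)

∣fullColumns-isZeroOrOdd∣ : ∀ q → ∣ fullColumns isZeroOrOdd (suc q * 2) ∣ ≡ 4 + q * 2
∣fullColumns-isZeroOrOdd∣ q = cong (2 +_) (∣fullColumns-isEven∣ q)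

odd-ladder : ∀ q → REDLD≡ (Ladder (suc (q * 2))) (suc (q * 2) + 1)
odd-ladder q = (fullColumns isEven (suc (q * 2)) , fullColumns-REDLD isEven _ (isEven-flanked q) ,
                trans (∣fullColumns-isEven∣ q) (+-comm 1 (suc (q * 2))))
             , λ S red → subst (_≤ ∣ S ∣) (+-comm 1 (suc (q * 2))) (odd-ladder-REDLD-size q red)

even-ladder : ∀ q → REDLD≡ (Ladder (suc q * 2)) (suc q * 2 + 2)
even-ladder q = (fullColumns isZeroOrOdd (suc q * 2) , fullColumns-REDLD isZeroOrOdd _ (isZeroOrOdd-flanked q) ,
                 trans (∣fullColumns-isZeroOrOdd∣ q) (+-comm 2 (suc q * 2)))
              , λ S red → subst (_≤ ∣ S ∣) (+-comm 2 (suc q * 2)) (even-ladder-REDLD-size q red)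

theorem7 : (k : ℕ) → 1 ≤ k →
    (k % 2 ≡ 1 → REDLD≡ (Ladder k) (k + 1))
    × (k % 2 ≡ 0 → REDLD≡ (Ladder k) (k + 2))
theorem7 k 1≤k = odd , even
  where
  k≡ : k ≡ k % 2 + k / 2 * 2
  k≡ = m≡m%n+[m/n]*n k 2
  odd : k % 2 ≡ 1 → REDLD≡ (Ladder k) (k + 1)
  odd k%2≡1 = subst (λ k → REDLD≡ (Ladder k) (k + 1)) (sym (trans k≡ (cong (_+ k / 2 * 2) k%2≡1)))
                    (odd-ladder (k / 2))
  even : k % 2 ≡ 0 → REDLD≡ (Ladder k) (k + 2)
  even k%2≡0 with k / 2 | trans k≡ (cong (_+ k / 2 * 2) k%2≡0)
  ... | zero | k≡0 = contradiction (subst (1 ≤_) k≡0 1≤k) λ ()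
  ... | suc q | k≡ = subst (λ k → REDLD≡ (Ladder k) (k + 2)) (sym k≡) (even-ladder q)
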